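{- Let $T$ be a tree with $n\ge2$ vertices $v_1,\dots,v_n$ in which $v_n$ is a leaf adjacent to $v_{n-1}$. Let $t\in\{1,\dots,n-1\}$, $\ell\ge n$, and let $\nu\in\mathbb{Z}_{\ge0}^{n-1}$ be a near-minimally self-reachable configuration on $T\setminus v_n$ about $v_t$ with $\ell$ chips. Let $\nu_t$ be the number of chips $\nu$ has on $v_t$ and $d$ the degree of $v_t$ in $T\setminus v_n$. Then $(\nu-(\nu_t-d)e_t,\ \nu_t-d+1)$ is a near-minimally self-reachable configuration on $T$ about $v_n$ with $\ell+1$ chips.
   Context: $e_i$ denotes the $i$th standard basis vector of $\mathbb{Z}^{n-1}$, and $(x,y)$ denotes the vector in $\mathbb{Z}^n$ obtained by appending the entry $y$ to $x\in\mathbb{Z}^{n-1}$; $T\setminus v_n$ is the tree on $v_1,\dots,v_{n-1}$. A chip configuration on a tree is a vector of nonnegative integers indexed by its vertices. For a tree $G$ with Laplacian $\Delta(G)$ ($\Delta_{ii}=\deg(v_i)$, $\Delta_{ij}=-1$ for edges, $0$ otherwise), firing $v_i$ from $c$ produces $c-\Delta(G)e_i$, legal if $c_i\ge\deg(v_i)$. A configuration is self-reachable on $G$ if some nonempty finite sequence of legal firings starting from it returns to it. (Known: equivalently, it has at least $m-1$ chips on every $m$-vertex subtree.) On an $m$-vertex tree, a configuration is minimally self-reachable if self-reachable with exactly $m-1$ chips. A configuration $\nu$ is near-minimally self-reachable on $G$ if it is self-reachable and not minimally self-reachable, and there is a unique $i$ with $\nu-e_i$ self-reachable on $G$; it is then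 near-minimally self-reachable about $v_i$. -}

module Defs where

open import Data.Bool using (Bool; true; false; if_then_else_)
open import Data.Nat using (ℕ; zero; suc; _+_; _*_; _∸_; _≤_)
open import Data.Fin using (Fin; inject₁; fromℕ; _≟_)
open import Data.Vec using (Vec; lookup; tabulate; sum; _[_]≔_)
open import Data.List using (List; _∷_; []; length) renaming (_∷ʳ_ to _l∷ʳ_)
open import Data.List.Relation.Unary.Linked using (Linked)
open import Data.List.Relation.Unary.Unique.Propositional using (Unique)
open import Data.Product using (Σ; ∃; _×_; _,_)
open import Relation.Nullary using (¬_; does)
open import Relation.Binary.PropositionalEquality using (_≡_)
open import Relation.Binary.Construct.Closure.ReflexiveTransitive using (Star)

-- A finite simple graph on vertices Fin n (v_{i+1} is the vertex i).
record Graph (n : ℕ) : Set where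
  field
    adj    : Fin n → Fin n → Bool
    sym    : ∀ i j → adj i j ≡ adj j i
    irrefl : ∀ i → adj i i ≡ false
open Graph public

Adj : ∀ {n} → Graph n → Fin n → Fin n → Set
Adj G i j = adj G i j ≡ true

data Walk {n} (G : Graph n) : Fin n → Fin n → Set where
  here : ∀ u → Walk G u u
  step : ∀ {u v w} → Adj G u v → Walk G v w → Walk G u w

Connected : ∀ {n} → Graph n → Set
Connected {n} G = (u v : Fin n) → Walk G u v

HasCycle : ∀ {n} → Graph n → Set
HasCycle {n} G = Σ (Fin n) λ x → Σ (List (Fin n)) λ ys →
  (2 ≤ length ys) × Unique (x ∷ ys) × Linked (Adj G) ((x ∷ ys) l∷ʳ x)

IsTree : ∀ {n} → Graph n → Set
IsTree G = Connected G × ¬ HasCycle G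

deg : ∀ {n} → Graph n → Fin n → ℕ
deg G i = sum (tabulate λ j → if adj G i j then 1 else 0)

deleteLast : ∀ {m} → Graph (suc m) → Graph m
deleteLast G = record
  { adj = λ i j → adj G (inject₁ i) (inject₁ j)
  ; sym = λ i j → sym G (inject₁ i) (inject₁ j)
  ; irrefl = λ i → irrefl G (inject₁ i) }

Config : ℕ → Set
Config n = Vec ℕ n

fire : ∀ {n} → Graph n → Fin n → Config n → Config n
fire G i c = tabulate λ j →
  if does (j ≟ i) then lookup c j ∸ deg G i
  else (if adj G i j then suc (lookup c j) else lookup c j)

Step : ∀ {n} → Graph n → Config n → Config n → Set
Step {n} G c c' = Σ (Fin n) λ i → (deg G i ≤ lookup c i) × (c' ≡ fire G i c)

SelfReachable : ∀ {n} → Graph n → Config n → Set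
SelfReachable G c = ∃ λ c' → Step G c c' × Star (Step G) c' c

MinimallySelfReachable : ∀ {n} → Graph n → Config n → Set
MinimallySelfReachable {n} G c = SelfReachable G c × (sum c ≡ n ∸ 1)

-- c - e_i is a configuration (c_i ≥ 1) and is self-reachable
MinusSelfReachable : ∀ {n} → Graph n → Config n → Fin n → Set
MinusSelfReachable G c i =
  (1 ≤ lookup c i) × SelfReachable G (c [ i ]≔ (lookup c i ∸ 1))

NearMinSRAbout : ∀ {n} → Graph n → Config n → Fin n → Set
NearMinSRAbout G c i =
  SelfReachable G c × ¬ MinimallySelfReachable G c ×
  MinusSelfReachable G c i × (∀ j → MinusSelfReachable G c j → j ≡ i)

{-# OPTIONS --safe #-}

-- Self-reachability on a connected graph has a combinatorial certificate: an
-- injective ranking of the vertices in which every vertex holds at least as many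
-- chips as it has lower-ranked neighbours.  Firing every vertex once, highest rank
-- first, then returns to the start; conversely, ranking the vertices by their last
-- firings in a returning sequence gives such a certificate.
--
-- Take a ranking for ν − e_t on T ∖ vₙ; relative to ν, t has a spare chip.  If t
-- had a neighbour ranked above it, moving t to just above the lowest such neighbour
-- w would spend that chip and free one at w, so ν − e_w would be self-reachable
-- too, against uniqueness.  Hence every neighbour of t is ranked below t, and
-- d = deg t < ν_t.  The ranking still works once ν_t is lowered to d, and putting
-- the leaf vₙ on top shows that the new configuration stays self-reachable even
-- without one chip at vₙ.  A ranking for it minus a chip at an inner vertex
-- restricts to T ∖ vₙ, where the same exchange argument (at t) or monotonicity in
-- the chips (elsewhere) contradicts the uniqueness of t.

module Submission where

open import Defs renaming (sym to adj-sym)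
open import Level using (0ℓ)
open import Data.Bool using (Bool; true; false; if_then_else_; T; _∨_)
open import Data.Bool.Properties using (T-∨; if-float) renaming (_≟_ to _≟ᵇ_)
open import Data.Fin using (Fin; zero; suc; inject₁; fromℕ; punchIn; _≟_)
open import Data.Fin.Properties using (any?; punchInᵢ≢i; inject₁-injective; fromℕ≢inject₁)
open import Data.List using (filter; allFin)
open import Data.List.Extrema.Nat using (argmin; argmin-all; f[argmin]≤f[xs])
open import Data.List.Membership.Propositional.Properties using (∈-filter⁺; ∈-allFin)
open import Data.List.Relation.Unary.All using () renaming (lookup to All-lookup)
open import Data.List.Relation.Unary.All.Properties using (all-filter)
open import Data.Nat using (ℕ; zero; suc; _+_; _*_; _∸_; _≤_; _<_; _≮_; z≤n; s≤s; s≤s⁻¹; _<?_; _≤?_)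
open import Data.Nat.Properties renaming (_≟_ to _≟ℕ_)
open import Algebra.Properties.CommutativeMonoid.Sum +-0-commutativeMonoid
  using (sum-cong-≗; sum-remove; sum-init-last; sum-replicate-zero; ∑-distrib-+)
  renaming (sum to ∑)
open import Algebra.Properties.CommutativeSemigroup +-commutativeSemigroup using (x∙yz≈y∙xz; xy∙z≈zy∙x)
open import Data.Product using (_×_; _,_; ∃; ∃-syntax; proj₁; proj₂)
open import Data.Sum using (_⊎_; inj₁; inj₂; [_,_])
open import Data.Vec using (Vec; []; _∷_; lookup; sum; tabulate; _[_]≔_; _∷ʳ_)
open import Data.Vec.Functional using (removeAt)
open import Data.Vec.Properties using (lookup∘tabulate; tabulate∘lookup; tabulate-cong; lookup∘update; lookup∘update′)
open import Function.Base using (_∘_)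
open import Function.Bundles using (_⇔_; Equivalence; mk⇔)
open import Function.Definitions using (Injective)
open import Relation.Binary.Construct.Closure.ReflexiveTransitive using (Star; ε; _◅_)
open import Relation.Binary.Definitions using (tri<; tri≈; tri>)
open import Relation.Binary.PropositionalEquality
  using (_≡_; _≢_; refl; sym; trans; cong; cong₂; subst; subst₂; module ≡-Reasoning)
open import Relation.Nullary using (¬_; Dec; yes; no; does; contradiction)
open import Relation.Nullary.Decidable using (T?; ⊤-dec; _×-dec_; dec-true; dec-false)
open import Relation.Unary using (Pred; Decidable)

private variable
  A : Set
  m n : ℕ

sum-tabulate : (f : Fin n → ℕ) → sum (tabulate f) ≡ ∑ f
sum-tabulate {zero}  f = refl
sum-tabulate {suc n} f = cong (f zero +_) (sum-tabulate (λ j → f (suc j)))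

∑-mono : {f g : Fin n → ℕ} → (∀ j → f j ≤ g j) → ∑ f ≤ ∑ g
∑-mono {zero}  f≤g = z≤n
∑-mono {suc n} f≤g = +-mono-≤ (f≤g zero) (∑-mono (λ j → f≤g (suc j)))

∑-zero : {f : Fin n → ℕ} → (∀ j → f j ≡ 0) → ∑ f ≡ 0
∑-zero {n} f≡0 = trans (sum-cong-≗ f≡0) (sum-replicate-zero n)

-- ∑ f − f w ≤ ∑ g − g w, rearranged so that no subtraction occurs.
∑-mono-except : ∀ {f g : Fin n → ℕ} w → (∀ j → j ≢ w → f j ≤ g j) →
                g w + ∑ f ≤ f w + ∑ g
∑-mono-except {suc n} {f} {g} w f≤g = begin
  g w + ∑ f                           ≡⟨ cong (g w +_) (sum-remove f) ⟩
  g w + (f w + ∑ (removeAt f w))      ≤⟨ +-monoʳ-≤ (g w) (+-monoʳ-≤ (f w) rest) ⟩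
  g w + (f w + ∑ (removeAt g w))      ≡⟨ x∙yz≈y∙xz (g w) (f w) _ ⟩
  f w + (g w + ∑ (removeAt g w))      ≡⟨ cong (f w +_) (sum-remove g) ⟨
  f w + ∑ g                           ∎
  where
  open ≤-Reasoning
  rest : ∑ (removeAt f w) ≤ ∑ (removeAt g w)
  rest = ∑-mono (λ i → f≤g (punchIn w i) (punchInᵢ≢i w i))

term≤∑ : ∀ (f : Fin n → ℕ) i → f i ≤ ∑ f
term≤∑ {suc n} f i = ≤-trans (m≤m+n (f i) _) (≤-reflexive (sym (sum-remove {i = i} f)))

𝟙 : Bool → ℕ
𝟙 b = if b then 1 else 0

Adj-sym : ∀ (G : Graph n) {u v} → Adj G u v → Adj G v u
Adj-sym G {u} {v} e = trans (adj-sym G v u) e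

Adj⇒≢ : ∀ (G : Graph n) {u v} → Adj G u v → u ≢ v
Adj⇒≢ G e refl with () ← trans (sym e) (irrefl G _)

closed-under-Walk : ∀ {G : Graph n} (P : Fin n → Set) → (∀ {u w} → P u → Adj G u w → P w) →
                    ∀ {a b} → Walk G a b → P a → P b
closed-under-Walk P closed (here _)    pa = pa
closed-under-Walk P closed (step e ws) pa = closed-under-Walk P closed ws (closed pa e)

#neighbours : (G : Graph n) → Fin n → {P : Pred (Fin n) 0ℓ} → Decidable P → ℕ
#neighbours G u P? = ∑ (λ j → if adj G u j then 𝟙 (does (P? j)) else 0)

deg≡#neighbours : (G : Graph n) (u : Fin n) → deg G u ≡ #neighbours G u (λ _ → ⊤-dec)
deg≡#neighbours G u = sum-tabulate (λ j → if adj G u j then 1 else 0)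

module _ (G : Graph n) (u : Fin n) where

  private
    term : {R : Pred (Fin n) 0ℓ} → Decidable R → Fin n → ℕ
    term R? j = if adj G u j then 𝟙 (does (R? j)) else 0

    term-mono : ∀ {R S : Pred (Fin n) 0ℓ} (R? : Decidable R) (S? : Decidable S) {j} →
                (Adj G u j → R j → S j) → term R? j ≤ term S? j
    term-mono R? S? {j} R⇒S with adj G u j | R? j | S? j
    ... | false | _     | _     = z≤n
    ... | true  | no _  | _     = z≤n
    ... | true  | yes _ | yes _ = ≤-refl
    ... | true  | yes r | no ¬s = contradiction (R⇒S refl r) ¬s

    term-no : ∀ {R : Pred (Fin n) 0ℓ} (R? : Decidable R) {j} → (Adj G u j → ¬ R j) → term R? j ≡ 0
    term-no R? {j} ¬r with adj G u j
    ... | false = refl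
    ... | true  = cong 𝟙 (dec-false (R? j) (¬r refl))

    term-yes : ∀ {R : Pred (Fin n) 0ℓ} (R? : Decidable R) {j} → R j → term R? j ≡ 𝟙 (adj G u j)
    term-yes R? {j} r with adj G u j
    ... | false = refl
    ... | true  = cong 𝟙 (dec-true (R? j) r)

    term≤1 : ∀ {R : Pred (Fin n) 0ℓ} (R? : Decidable R) j → term R? j ≤ 𝟙 (adj G u j)
    term≤1 R? j = term-mono R? (λ _ → ⊤-dec) (λ _ _ → _)

  module _ {P Q : Pred (Fin n) 0ℓ} (P? : Decidable P) (Q? : Decidable Q) where

    #neighbours-mono : (∀ {j} → Adj G u j → P j → Q j) → #neighbours G u P? ≤ #neighbours G u Q?
    #neighbours-mono P⇒Q = ∑-mono (λ j → term-mono P? Q? {j} P⇒Q)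

    #neighbours-monoExcept : ∀ w → (∀ {j} → j ≢ w → Adj G u j → P j → Q j) →
                             #neighbours G u P? ≤ 𝟙 (adj G u w) + #neighbours G u Q?
    #neighbours-monoExcept w P⇒Q = begin
      #neighbours G u P?                   ≤⟨ m≤n+m _ (term Q? w) ⟩
      term Q? w + #neighbours G u P?       ≤⟨ ∑-mono-except w (λ j j≢w → term-mono P? Q? {j} (P⇒Q j≢w)) ⟩
      term P? w + #neighbours G u Q?       ≤⟨ +-monoˡ-≤ _ (term≤1 P? w) ⟩
      𝟙 (adj G u w) + #neighbours G u Q?   ∎
      where open ≤-Reasoning

    #neighbours-<-at : ∀ {w} → Adj G u w → ¬ P w → Q w → (∀ {j} → j ≢ w → Adj G u j → P j → Q j) →
                       #neighbours G u P? < #neighbours G u Q?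
    #neighbours-<-at {w} uw ¬pw qw P⇒Q = begin
      1 + #neighbours G u P?           ≡⟨ cong (_+ _) (trans (term-yes Q? qw) (cong 𝟙 uw)) ⟨
      term Q? w + #neighbours G u P?   ≤⟨ ∑-mono-except w (λ j j≢w → term-mono P? Q? {j} (P⇒Q j≢w)) ⟩
      term P? w + #neighbours G u Q?   ≡⟨ cong (_+ _) (term-no P? (λ _ → ¬pw)) ⟩
      #neighbours G u Q?               ∎
      where open ≤-Reasoning

    #neighbours-insert : ∀ w → ¬ P w → Q w → (∀ {j} → j ≢ w → P j ⇔ Q j) →
                         #neighbours G u Q? ≡ 𝟙 (adj G u w) + #neighbours G u P?
    #neighbours-insert w ¬pw qw P⇔Q = ≤-antisym
      (begin
        #neighbours G u Q?                 ≡⟨ cong (_+ _) (term-no P? (λ _ → ¬pw)) ⟨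
        term P? w + #neighbours G u Q?     ≤⟨ ∑-mono-except w (λ j j≢w → term-mono Q? P? {j} (λ _ → Q⇒P j≢w)) ⟩
        term Q? w + #neighbours G u P?     ≡⟨ cong (_+ _) (term-yes Q? qw) ⟩
        𝟙 (adj G u w) + #neighbours G u P? ∎)
      (begin
        𝟙 (adj G u w) + #neighbours G u P? ≡⟨ cong (_+ _) (term-yes Q? qw) ⟨
        term Q? w + #neighbours G u P?     ≤⟨ ∑-mono-except w (λ j j≢w → term-mono P? Q? {j} (λ _ → P⇒Q j≢w)) ⟩
        term P? w + #neighbours G u Q?     ≡⟨ cong (_+ _) (term-no P? (λ _ → ¬pw)) ⟩
        #neighbours G u Q?                 ∎)
      where
      open ≤-Reasoning
      P⇒Q = λ {j} j≢w → Equivalence.to (P⇔Q {j} j≢w)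
      Q⇒P = λ {j} j≢w → Equivalence.from (P⇔Q {j} j≢w)

    #neighbours-cong : (∀ {j} → Adj G u j → P j ⇔ Q j) → #neighbours G u P? ≡ #neighbours G u Q?
    #neighbours-cong P⇔Q = ≤-antisym
      (#neighbours-mono (λ uj → Equivalence.to (P⇔Q uj)))
      (∑-mono (λ j → term-mono Q? P? {j} (λ uj → Equivalence.from (P⇔Q uj))))

    deg≤#neighbours-+ : (∀ {j} → Adj G u j → P j ⊎ Q j) → deg G u ≤ #neighbours G u P? + #neighbours G u Q?
    deg≤#neighbours-+ P∪Q = begin
      deg G u                                   ≡⟨ deg≡#neighbours G u ⟩
      ∑ (term (λ _ → ⊤-dec))                    ≤⟨ ∑-mono split ⟩
      ∑ (λ j → term P? j + term Q? j)           ≡⟨ ∑-distrib-+ (term P?) (term Q?) ⟩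
      #neighbours G u P? + #neighbours G u Q?   ∎
      where
      open ≤-Reasoning
      split : ∀ j → term (λ _ → ⊤-dec) j ≤ term P? j + term Q? j
      split j with adj G u j in e | P? j | Q? j
      ... | false | _     | _     = z≤n
      ... | true  | yes _ | _     = s≤s z≤n
      ... | true  | no _  | yes _ = s≤s z≤n
      ... | true  | no ¬p | no ¬q = contradiction (P∪Q e) [ ¬p , ¬q ]

  module _ {P : Pred (Fin n) 0ℓ} (P? : Decidable P) where

    #neighbours≤deg : #neighbours G u P? ≤ deg G u
    #neighbours≤deg = ≤-trans (#neighbours-mono P? (λ _ → ⊤-dec) (λ _ _ → _))
                              (≤-reflexive (sym (deg≡#neighbours G u)))

    #neighbours-none : (∀ {j} → Adj G u j → ¬ P j) → #neighbours G u P? ≡ 0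
    #neighbours-none ¬P = ∑-zero (λ j → term-no P? {j} ¬P)

    #neighbours-all : (∀ {j} → Adj G u j → P j) → #neighbours G u P? ≡ deg G u
    #neighbours-all all = trans (#neighbours-cong P? (λ _ → ⊤-dec) (λ uj → mk⇔ (λ _ → _) (λ _ → all uj)))
                                (sym (deg≡#neighbours G u))

    #neighbours-pos : ∀ {w} → Adj G u w → P w → 0 < #neighbours G u P?
    #neighbours-pos {w} uw pw = ≤-trans (≤-reflexive (sym (trans (term-yes P? pw) (cong 𝟙 uw)))) (term≤∑ (term P?) w)

deg≤1⇒neighbour-unique : ∀ (G : Graph n) {u x y} → deg G u ≤ 1 → Adj G u x → Adj G u y → x ≡ y
deg≤1⇒neighbour-unique G {u} {x} {y} deg≤1 ux uy with x ≟ y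
... | yes x≡y = x≡y
... | no x≢y = contradiction deg≤1 (<⇒≱ (begin-strict
  1                                ≤⟨ #neighbours-pos G u (_≟ y) uy refl ⟩
  #neighbours G u (_≟ y)           <⟨ #neighbours-<-at G u (_≟ y) (λ _ → ⊤-dec) ux x≢y _ (λ _ _ _ → _) ⟩
  #neighbours G u (λ _ → ⊤-dec)    ≡⟨ deg≡#neighbours G u ⟨
  deg G u                          ∎))
  where open ≤-Reasoning

removeChip : Config n → Fin n → Config n
removeChip c i = c [ i ]≔ (lookup c i ∸ 1)

module _ {f : Fin n → ℕ} (c : Config n) (i : Fin n) where

  ≤-removeChip⁺ : (∀ u → u ≢ i → f u ≤ lookup c u) → f i < lookup c i → ∀ u → f u ≤ lookup (removeChip c i) u
  ≤-removeChip⁺ f≤c fi<ci u with u ≟ i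
  ... | yes refl = subst (f u ≤_) (sym (lookup∘update u c _)) (∸-monoˡ-≤ 1 fi<ci)
  ... | no u≢i   = subst (f u ≤_) (sym (lookup∘update′ u≢i c _)) (f≤c u u≢i)

  ≤-removeChip⁻ : (∀ u → f u ≤ lookup (removeChip c i) u) → ∀ u → u ≢ i → f u ≤ lookup c u
  ≤-removeChip⁻ f≤c′ u u≢i = subst (f u ≤_) (lookup∘update′ u≢i c _) (f≤c′ u)

  <-removeChip⁻ : (∀ u → f u ≤ lookup (removeChip c i) u) → 1 ≤ lookup c i → f i < lookup c i
  <-removeChip⁻ f≤c′ 1≤ci = begin-strict
    f i                         ≤⟨ subst (f i ≤_) (lookup∘update i c _) (f≤c′ i) ⟩
    lookup c i ∸ 1              <⟨ n<1+n _ ⟩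
    1 + (lookup c i ∸ 1)        ≡⟨ m+[n∸m]≡n 1≤ci ⟩
    lookup c i                  ∎
    where open ≤-Reasoning

removeChip-mono : ∀ {c c′ : Config n} → (∀ u → lookup c u ≤ lookup c′ u) →
                  ∀ i u → lookup (removeChip c i) u ≤ lookup (removeChip c′ i) u
removeChip-mono {c = c} {c′} c≤c′ i u with u ≟ i
... | yes refl = subst₂ _≤_ (sym (lookup∘update u c _)) (sym (lookup∘update u c′ _)) (∸-monoˡ-≤ 1 (c≤c′ u))
... | no u≢i   = subst₂ _≤_ (sym (lookup∘update′ u≢i c _)) (sym (lookup∘update′ u≢i c′ _)) (c≤c′ u)

lookup∘fire-self : ∀ (G : Graph n) i (c : Config n) → lookup (fire G i c) i ≡ lookup c i ∸ deg G i
lookup∘fire-self G i c =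
  trans (lookup∘tabulate _ i) (cong (if_then lookup c i ∸ deg G i else stay) (dec-true (i ≟ i) refl))
  where stay = if adj G i i then suc (lookup c i) else lookup c i

lookup∘fire-other : ∀ (G : Graph n) {i j} (c : Config n) → j ≢ i →
                    lookup (fire G i c) j ≡ 𝟙 (adj G i j) + lookup c j
lookup∘fire-other G {i} {j} c j≢i = begin
  lookup (fire G i c) j                                  ≡⟨ lookup∘tabulate _ j ⟩
  (if does (j ≟ i) then lookup c j ∸ deg G i else gain)  ≡⟨ cong (if_then lookup c j ∸ deg G i else gain) (dec-false (j ≟ i) j≢i) ⟩
  gain                                                   ≡⟨ if-float (_+ lookup c j) (adj G i j) ⟨
  𝟙 (adj G i j) + lookup c j                             ∎
  where
  open ≡-Reasoning
  gain = if adj G i j then suc (lookup c j) else lookup c j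

-- Firing orders

-- Ranks encode a firing order, highest rank first: #later G K u counts the neighbours
-- of u that fire after u, each of which gives u back a chip.
#later : Graph n → (Fin n → ℕ) → Fin n → ℕ
#later G K u = #neighbours G u (λ j → K j <? K u)

strictBound : (Fin n → ℕ) → ℕ
strictBound K = ∑ (λ u → suc (K u))

<strictBound : ∀ (K : Fin n → ℕ) u → K u < strictBound K
<strictBound K = term≤∑ (λ u → suc (K u))

record FiringOrder (G : Graph n) (c : Config n) : Set where
  field
    rank           : Fin n → ℕ
    rank-injective : Injective _≡_ _≡_ rank
    #later≤chips   : ∀ u → #later G rank u ≤ lookup c u

firingOrder-mono : ∀ {G : Graph n} {c c′} → FiringOrder G c → (∀ u → lookup c u ≤ lookup c′ u) → FiringOrder G c′
firingOrder-mono σ c≤c′ = record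
  { rank = rank ; rank-injective = rank-injective ; #later≤chips = λ u → ≤-trans (#later≤chips u) (c≤c′ u) }
  where open FiringOrder σ

module FireInRankOrder {G : Graph n} {c : Config n} (σ : FiringOrder G c) where
  open FiringOrder σ renaming (rank to K)

  firedDeg : ℕ → Fin n → ℕ
  firedDeg k u = if does (k ≤? K u) then deg G u else 0

  #firedNeighbours : ℕ → Fin n → ℕ
  #firedNeighbours k u = #neighbours G u (λ j → k ≤? K j)

  -- x is c after firing once each vertex of rank ≥ k (stated without subtraction)
  Fired : ℕ → Config n → Set
  Fired k x = ∀ u → lookup x u + firedDeg k u ≡ lookup c u + #firedNeighbours k u

  private
    suc≤⇔≤ : ∀ {k m} → m ≢ k → suc k ≤ m ⇔ k ≤ m
    suc≤⇔≤ m≢k = mk⇔ <⇒≤ (λ k≤m → ≤∧≢⇒< k≤m (λ k≡m → m≢k (sym k≡m)))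

    neighbour-rank≢ : ∀ {u j} → Adj G u j → K j ≢ K u
    neighbour-rank≢ uj Kj≡Ku = Adj⇒≢ G uj (sym (rank-injective Kj≡Ku))

  firedDeg-yes : ∀ {k u} → k ≤ K u → firedDeg k u ≡ deg G u
  firedDeg-yes {k} {u} k≤u = cong (if_then deg G u else 0) (dec-true (k ≤? K u) k≤u)

  firedDeg-no : ∀ {k u} → ¬ k ≤ K u → firedDeg k u ≡ 0
  firedDeg-no {k} {u} k≰u = cong (if_then deg G u else 0) (dec-false (k ≤? K u) k≰u)

  firedDeg-suc : ∀ {k} u → K u ≢ k → firedDeg (suc k) u ≡ firedDeg k u
  firedDeg-suc {k} u Ku≢k with k ≤? K u
  ... | yes k≤u = trans (firedDeg-yes (Equivalence.from (suc≤⇔≤ Ku≢k) k≤u)) (sym (firedDeg-yes k≤u))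
  ... | no k≰u  = trans (firedDeg-no (λ k<u → k≰u (<⇒≤ k<u))) (sym (firedDeg-no k≰u))

  #firedNeighbours-suc : ∀ {k} u → (∀ {j} → Adj G u j → K j ≢ k) →
                         #firedNeighbours (suc k) u ≡ #firedNeighbours k u
  #firedNeighbours-suc {k} u ≢k = #neighbours-cong G u (λ j → suc k ≤? K j) (λ j → k ≤? K j)
                                    (λ uj → suc≤⇔≤ (≢k uj))

  Fired⇒unfired-chips : ∀ {k x u} → K u ≡ k → Fired (suc k) x →
                        lookup x u ≡ lookup c u + #firedNeighbours (suc k) u
  Fired⇒unfired-chips {k} {x} {u} Ku≡k fired = begin
    lookup x u                               ≡⟨ +-identityʳ _ ⟨
    lookup x u + 0                           ≡⟨ cong (lookup x u +_) (firedDeg-no (<-irrefl (sym Ku≡k))) ⟨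
    lookup x u + firedDeg (suc k) u          ≡⟨ fired u ⟩
    lookup c u + #firedNeighbours (suc k) u  ∎
    where open ≡-Reasoning

  fire-legal : ∀ {k x u} → K u ≡ k → Fired (suc k) x → deg G u ≤ lookup x u
  fire-legal {k} {x} {u} Ku≡k fired = begin
    deg G u                                    ≤⟨ deg≤#neighbours-+ G u (λ j → suc k ≤? K j) (λ j → K j <? K u) split ⟩
    #firedNeighbours (suc k) u + #later G K u  ≤⟨ +-monoʳ-≤ _ (#later≤chips u) ⟩
    #firedNeighbours (suc k) u + lookup c u    ≡⟨ +-comm (#firedNeighbours (suc k) u) (lookup c u) ⟩
    lookup c u + #firedNeighbours (suc k) u    ≡⟨ Fired⇒unfired-chips {x = x} Ku≡k fired ⟨
    lookup x u                                 ∎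
    where
    open ≤-Reasoning
    split : ∀ {j} → Adj G u j → suc k ≤ K j ⊎ K j < K u
    split {j} uj with suc k ≤? K j
    ... | yes k<j = inj₁ k<j
    ... | no  k≮j = inj₂ (≤∧≢⇒< (subst (K j ≤_) (sym Ku≡k) (s≤s⁻¹ (≰⇒> k≮j))) (neighbour-rank≢ uj))

  fire-next : ∀ {k x u} → K u ≡ k → Fired (suc k) x → Fired k (fire G u x)
  fire-next {k} {x} {u} Ku≡k fired v with v ≟ u
  ... | yes refl = begin
    lookup (fire G u x) u + firedDeg k u     ≡⟨ cong₂ _+_ (lookup∘fire-self G u x) (firedDeg-yes (≤-reflexive (sym Ku≡k))) ⟩
    lookup x u ∸ deg G u + deg G u           ≡⟨ m∸n+n≡m (fire-legal {x = x} Ku≡k fired) ⟩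
    lookup x u                               ≡⟨ Fired⇒unfired-chips {x = x} Ku≡k fired ⟩
    lookup c u + #firedNeighbours (suc k) u  ≡⟨ cong (lookup c u +_) (#firedNeighbours-suc u ≢k) ⟩
    lookup c u + #firedNeighbours k u        ∎
    where
    open ≡-Reasoning
    ≢k : ∀ {j} → Adj G u j → K j ≢ k
    ≢k uj Kj≡k = neighbour-rank≢ uj (trans Kj≡k (sym Ku≡k))
  ... | no v≢u = begin
    lookup (fire G u x) v + firedDeg k v      ≡⟨ cong₂ _+_ (lookup∘fire-other G x v≢u) (sym (firedDeg-suc v Kv≢k)) ⟩
    𝟙 (adj G u v) + lookup x v + firedDeg (suc k) v
                                              ≡⟨ +-assoc (𝟙 (adj G u v)) (lookup x v) (firedDeg (suc k) v) ⟩
    𝟙 (adj G u v) + (lookup x v + firedDeg (suc k) v)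
                                              ≡⟨ cong (𝟙 (adj G u v) +_) (fired v) ⟩
    𝟙 (adj G u v) + (lookup c v + F)          ≡⟨ x∙yz≈y∙xz (𝟙 (adj G u v)) (lookup c v) F ⟩
    lookup c v + (𝟙 (adj G u v) + F)          ≡⟨ cong (λ b → lookup c v + (𝟙 b + F)) (adj-sym G u v) ⟩
    lookup c v + (𝟙 (adj G v u) + F)          ≡⟨ cong (lookup c v +_) gains-u ⟨
    lookup c v + #firedNeighbours k v         ∎
    where
    open ≡-Reasoning
    F = #firedNeighbours (suc k) v
    Kv≢k : K v ≢ k
    Kv≢k Kv≡k = v≢u (rank-injective (trans Kv≡k (sym Ku≡k)))
    gains-u : #firedNeighbours k v ≡ 𝟙 (adj G v u) + F
    gains-u = #neighbours-insert G v (λ j → suc k ≤? K j) (λ j → k ≤? K j) u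
      (<-irrefl (sym Ku≡k)) (≤-reflexive (sym Ku≡k))
      (λ j≢u → suc≤⇔≤ (λ Kj≡k → j≢u (rank-injective (trans Kj≡k (sym Ku≡k)))))

  skip : ∀ {k x} → (∀ u → K u ≢ k) → Fired (suc k) x → Fired k x
  skip {k} {x} none fired u = begin
    lookup x u + firedDeg k u                ≡⟨ cong (lookup x u +_) (firedDeg-suc u (none u)) ⟨
    lookup x u + firedDeg (suc k) u          ≡⟨ fired u ⟩
    lookup c u + #firedNeighbours (suc k) u  ≡⟨ cong (lookup c u +_) (#firedNeighbours-suc u (λ {j} _ → none j)) ⟩
    lookup c u + #firedNeighbours k u        ∎
    where open ≡-Reasoning

  advance : ∀ k x → Fired (suc k) x →
            (∃[ u ] Step G x (fire G u x) × Fired k (fire G u x)) ⊎ ((∀ u → K u ≢ k) × Fired k x)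
  advance k x fired with any? (λ u → K u ≟ℕ k)
  ... | yes (u , Ku≡k) = inj₁ (u , (u , fire-legal {x = x} Ku≡k fired , refl) , fire-next {x = x} Ku≡k fired)
  ... | no ∄u          = inj₂ (none , skip {x = x} none fired)
    where none = λ u Ku≡k → ∄u (u , Ku≡k)

  Fired-zero⇒≡ : ∀ {x} → Fired 0 x → x ≡ c
  Fired-zero⇒≡ {x} fired = begin
    x                    ≡⟨ tabulate∘lookup x ⟨
    tabulate (lookup x)  ≡⟨ tabulate-cong (λ u → +-cancelʳ-≡ _ _ _ (same u)) ⟩
    tabulate (lookup c)  ≡⟨ tabulate∘lookup c ⟩
    c                    ∎
    where
    open ≡-Reasoning
    same : ∀ u → lookup x u + deg G u ≡ lookup c u + deg G u
    same u = trans (cong (lookup x u +_) (sym (firedDeg-yes z≤n)))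
                   (trans (fired u) (cong (lookup c u +_) (#neighbours-all G u (λ j → 0 ≤? K j) (λ _ → z≤n))))

  fireAll : ∀ k x → Fired k x → Star (Step G) x c
  fireAll zero    x fired = subst (λ y → Star (Step G) y c) (sym (Fired-zero⇒≡ fired)) ε
  fireAll (suc k) x fired with advance k x fired
  ... | inj₁ (u , firing , fired′) = firing ◅ fireAll k (fire G u x) fired′
  ... | inj₂ (_ , fired′)        = fireAll k x fired′

  fireAll⁺ : ∀ {u₀} k x → K u₀ < k → Fired k x → ∃[ y ] Step G x y × Star (Step G) y c
  fireAll⁺ {u₀} (suc k) x Ku₀<sk fired with advance k x fired
  ... | inj₁ (u , firing , fired′) = fire G u x , firing , fireAll k (fire G u x) fired′
  ... | inj₂ (none , fired′)     = fireAll⁺ k x (≤∧≢⇒< (s≤s⁻¹ Ku₀<sk) (none u₀)) fired′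

  Fired-initial : Fired (strictBound K) c
  Fired-initial u = cong (lookup c u +_) (trans (firedDeg-no (<⇒≱ (<strictBound K u)))
    (sym (#neighbours-none G u (λ j → strictBound K ≤? K j) (λ {j} _ → <⇒≱ (<strictBound K j)))))

firingOrder⇒selfReachable : ∀ {G : Graph n} {c} → FiringOrder G c → Fin n → SelfReachable G c
firingOrder⇒selfReachable {c = c} σ u₀ = fireAll⁺ (strictBound rank) c (<strictBound rank u₀) Fired-initial
  where
  open FiringOrder σ using (rank)
  open FireInRankOrder σ

-- Rankings from firing sequences

-- Along a legal firing sequence from x to c, the vertices that fire are ranked by
-- their last firings (the later the last firing, the smaller the rank).
record LastFirings (G : Graph n) (c x : Config n) : Set where
  field
    fired          : Fin n → Bool
    rank           : Fin n → ℕ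
    rank-bound     : ℕ
    rank<bound     : ∀ {u} → T (fired u) → rank u < rank-bound
    rank-injective : ∀ {u v} → T (fired u) → T (fired v) → rank u ≡ rank v → u ≡ v
    #later≤chips   : ∀ {u} → T (fired u) →
                     #neighbours G u (λ w → T? (fired w) ×-dec (rank w <? rank u)) ≤ lookup c u
    unfired-chips  : ∀ {u} → ¬ T (fired u) → lookup x u + #neighbours G u (T? ∘ fired) ≤ lookup c u

module _ {G : Graph n} {c : Config n} where

  lastFirings-none : LastFirings G c c
  lastFirings-none = record
    { fired = λ _ → false ; rank = λ _ → 0 ; rank-bound = 0
    ; rank<bound = λ () ; rank-injective = λ () ; #later≤chips = λ ()
    ; unfired-chips = λ {u} _ → ≤-reflexive (trans (cong (lookup c u +_) (#neighbours-none G u (λ w → T? false) (λ _ ())))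
                                                    (+-identityʳ _)) }

  module FirstFiring {x} i (legal : deg G i ≤ lookup x i) (L : LastFirings G c (fire G i x)) where
    open LastFirings L renaming
      (fired to fired′; rank to rank′; rank-bound to bound′; rank<bound to rank′<bound′;
       rank-injective to rank′-injective; #later≤chips to #later′≤chips; unfired-chips to unfired′-chips)

    fired : Fin n → Bool
    fired u = fired′ u ∨ does (u ≟ i)

    rank : Fin n → ℕ
    rank u = if fired′ u then rank′ u else bound′

    fired-i : T (fired i)
    fired-i rewrite dec-true (i ≟ i) refl = Equivalence.from (T-∨ {fired′ i}) (inj₂ _)

    fired′⇒fired : ∀ {u} → T (fired′ u) → T (fired u)
    fired′⇒fired f′u = Equivalence.from T-∨ (inj₁ f′u)

    fired⇒fired′ : ∀ {u} → u ≢ i → T (fired u) → T (fired′ u)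
    fired⇒fired′ {u} u≢i fu with fired′ u | u ≟ i
    ... | true  | _        = _
    ... | false | yes u≡i  = contradiction u≡i u≢i
    ... | false | no _     = fu

    rank<bound : ∀ {u} → T (fired u) → rank u < suc bound′
    rank<bound {u} _ with fired′ u in e
    ... | true  = m<n⇒m<1+n (rank′<bound′ (subst T (sym e) _))
    ... | false = ≤-refl

    private
      chosen⇒≡ : ∀ {u} → T (does (u ≟ i)) → u ≡ i
      chosen⇒≡ {u} t with u ≟ i
      ... | yes u≡i = u≡i

    rank-injective : ∀ {u v} → T (fired u) → T (fired v) → rank u ≡ rank v → u ≡ v
    rank-injective {u} {v} fu fv eq with fired′ u in eu | fired′ v in ev
    ... | true  | true  = rank′-injective (subst T (sym eu) _) (subst T (sym ev) _) eq
    ... | true  | false = contradiction eq (<⇒≢ (rank′<bound′ (subst T (sym eu) _)))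
    ... | false | true  = contradiction (sym eq) (<⇒≢ (rank′<bound′ (subst T (sym ev) _)))
    ... | false | false = trans (chosen⇒≡ fu) (sym (chosen⇒≡ fv))

    #later≤chips : ∀ {u} → T (fired u) →
                   #neighbours G u (λ w → T? (fired w) ×-dec (rank w <? rank u)) ≤ lookup c u
    #later≤chips {u} fu with fired′ u in eu
    ... | true = ≤-trans (#neighbours-mono G u (λ w → T? (fired w) ×-dec (rank w <? rank′ u))
                                               (λ w → T? (fired′ w) ×-dec (rank′ w <? rank′ u)) still-later)
                         (#later′≤chips f′u)
      where
      f′u = subst T (sym eu) _
      still-later : ∀ {w} → Adj G u w → T (fired w) × rank w < rank′ u → T (fired′ w) × rank′ w < rank′ u
      still-later {w} _ (_ , w<u) with fired′ w
      ... | true  = _ , w<u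
      ... | false = contradiction (<-trans w<u (rank′<bound′ f′u)) (<-irrefl refl)
    ... | false with refl ← chosen⇒≡ {u} fu = begin
      #neighbours G i later?                                ≤⟨ #neighbours-mono G i later? (T? ∘ fired′) fired-neighbour ⟩
      #neighbours G i (T? ∘ fired′)                         ≤⟨ m≤n+m _ _ ⟩
      lookup (fire G i x) i + #neighbours G i (T? ∘ fired′)  ≤⟨ unfired′-chips (λ f′i → subst T eu f′i) ⟩
      lookup c i                                            ∎
      where
      open ≤-Reasoning
      later? = λ w → T? (fired w) ×-dec (rank w <? bound′)
      fired-neighbour : ∀ {w} → Adj G i w → T (fired w) × rank w < bound′ → T (fired′ w)
      fired-neighbour iw (fw , _) = fired⇒fired′ (λ w≡i → Adj⇒≢ G iw (sym w≡i)) fw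

    unfired-chips : ∀ {u} → ¬ T (fired u) → lookup x u + #neighbours G u (T? ∘ fired) ≤ lookup c u
    unfired-chips {u} ¬fu = begin
      lookup x u + #neighbours G u (T? ∘ fired)      ≤⟨ +-monoʳ-≤ (lookup x u) gained ⟩
      lookup x u + (𝟙 (adj G u i) + F′)              ≡⟨ x∙yz≈y∙xz (lookup x u) (𝟙 (adj G u i)) F′ ⟩
      𝟙 (adj G u i) + (lookup x u + F′)              ≡⟨ +-assoc (𝟙 (adj G u i)) (lookup x u) F′ ⟨
      𝟙 (adj G u i) + lookup x u + F′                ≡⟨ cong (λ b → 𝟙 b + lookup x u + F′) (adj-sym G u i) ⟩
      𝟙 (adj G i u) + lookup x u + F′                ≡⟨ cong (_+ F′) (lookup∘fire-other G x u≢i) ⟨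
      lookup (fire G i x) u + F′                     ≤⟨ unfired′-chips (λ f′u → ¬fu (fired′⇒fired f′u)) ⟩
      lookup c u                                     ∎
      where
      open ≤-Reasoning
      F′ = #neighbours G u (T? ∘ fired′)
      u≢i : u ≢ i
      u≢i refl = ¬fu fired-i
      gained : #neighbours G u (T? ∘ fired) ≤ 𝟙 (adj G u i) + F′
      gained = #neighbours-monoExcept G u (T? ∘ fired) (T? ∘ fired′) i (λ w≢i _ → fired⇒fired′ w≢i)

    lastFirings-fire : LastFirings G c x
    lastFirings-fire = record
      { fired = fired ; rank = rank ; rank-bound = suc bound′ ; rank<bound = rank<bound
      ; rank-injective = rank-injective ; #later≤chips = #later≤chips ; unfired-chips = unfired-chips }

  lastFirings : ∀ {x} → Star (Step G) x c → LastFirings G c x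
  lastFirings ε                            = lastFirings-none
  lastFirings ((i , legal , refl) ◅ rest) = FirstFiring.lastFirings-fire i legal (lastFirings rest)

selfReachable⇒firingOrder : ∀ {G : Graph n} {c} → Connected G → SelfReachable G c → FiringOrder G c
selfReachable⇒firingOrder {G = G} {c} connected (_ , (i , legal , refl) , rest) = record
  { rank = rank
  ; rank-injective = rank-injective (all-fired _) (all-fired _)
  ; #later≤chips = λ u → ≤-trans (≤-reflexive (#neighbours-cong G u (λ w → rank w <? rank u)
                                                  (λ w → T? (fired w) ×-dec (rank w <? rank u))
                                                  (λ {w} _ → mk⇔ (all-fired w ,_) proj₂)))
                                 (#later≤chips (all-fired u)) }
  where
  open FirstFiring {G = G} {c = c} {x = c} i legal (lastFirings rest)

  neighbours-fired : ∀ {u w} → T (fired u) → Adj G u w → T (fired w)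
  neighbours-fired {u} {w} fu uw with T? (fired w)
  ... | yes fw = fw
  ... | no ¬fw = contradiction (unfired-chips ¬fw) (<⇒≱ (m<m+n (lookup c w) has-fired-neighbour))
    where has-fired-neighbour = #neighbours-pos G w (T? ∘ fired) (Adj-sym G uw) fu

  all-fired : ∀ v → T (fired v)
  all-fired v = closed-under-Walk (λ u → T (fired u)) neighbours-fired (connected i v) fired-i

-- Moving a spare chip

argmin-satisfying : ∀ {P : Pred (Fin n) 0ℓ} → Decidable P → (f : Fin n → ℕ) → ∃ P →
                    ∃[ w ] P w × (∀ {x} → P x → f w ≤ f x)
argmin-satisfying {n} P? f (x₀ , px₀) =
  argmin f x₀ candidates ,
  argmin-all f px₀ (all-filter P? (allFin n)) ,
  λ px → All-lookup (f[argmin]≤f[xs] x₀ candidates) (∈-filter⁺ P? (∈-allFin _) px)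
  where candidates = filter P? (allFin n)

module SpareChipTransfer {G : Graph n} {c : Config n} {t : Fin n} {K : Fin n → ℕ}
  (K-injective : Injective _≡_ _≡_ K)
  (#later≤chips : ∀ u → u ≢ t → #later G K u ≤ lookup c u)
  (spare : #later G K t < lookup c t)
  (not-first : #later G K t < deg G t) where

  Above : Pred (Fin n) 0ℓ
  Above x = Adj G t x × K t < K x

  above? : Decidable Above
  above? x = (adj G t x ≟ᵇ true) ×-dec (K t <? K x)

  neighbour-above : ∃ Above
  neighbour-above with any? above?
  ... | yes found = found
  ... | no none   = contradiction (#neighbours-all G t (λ j → K j <? K t) below) (<⇒≢ not-first)
    where
    below : ∀ {j} → Adj G t j → K j < K t
    below {j} tj with <-cmp (K j) (K t)
    ... | tri< Kj<Kt _ _ = Kj<Kt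
    ... | tri≈ _ Kj≡Kt _ = contradiction (K-injective Kj≡Kt) (λ j≡t → Adj⇒≢ G tj (sym j≡t))
    ... | tri> _ _ Kt<Kj = contradiction (j , tj , Kt<Kj) none

  private
    lowest = argmin-satisfying above? K neighbour-above

  w : Fin n
  w = proj₁ lowest

  tw : Adj G t w
  tw = proj₁ (proj₁ (proj₂ lowest))

  Kt<Kw : K t < K w
  Kt<Kw = proj₂ (proj₁ (proj₂ lowest))

  lowest-above : ∀ {x} → Adj G t x → K t < K x → K w ≤ K x
  lowest-above tx Kt<Kx = proj₂ (proj₂ lowest) (tx , Kt<Kx)

  w≢t : w ≢ t
  w≢t w≡t = Adj⇒≢ G tw (sym w≡t)

  -- Doubling the ranks makes room to move t to just above w.
  K′ : Fin n → ℕ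
  K′ j = if does (j ≟ t) then suc (2 * K w) else 2 * K j

  K′-t : K′ t ≡ suc (2 * K w)
  K′-t = cong (if_then suc (2 * K w) else 2 * K t) (dec-true (t ≟ t) refl)

  K′-other : ∀ {j} → j ≢ t → K′ j ≡ 2 * K j
  K′-other {j} j≢t = cong (if_then suc (2 * K w) else 2 * K j) (dec-false (j ≟ t) j≢t)

  K′-injective : Injective _≡_ _≡_ K′
  K′-injective {x} {y} eq with x ≟ t | y ≟ t
  ... | yes x≡t | yes y≡t = trans x≡t (sym y≡t)
  ... | yes _   | no _    = contradiction (sym eq) (even≢odd (K y) (K w))
  ... | no _    | yes _   = contradiction eq (even≢odd (K x) (K w))
  ... | no _    | no _    = K-injective (*-cancelˡ-≡ (K x) (K y) 2 eq)

  #later′-t : #later G K′ t ≤ 1 + #later G K t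
  #later′-t = subst (λ b → #later G K′ t ≤ 𝟙 b + #later G K t) tw
    (#neighbours-monoExcept G t (λ j → K′ j <? K′ t) (λ j → K j <? K t) w still-later)
    where
    still-later : ∀ {j} → j ≢ w → Adj G t j → K′ j < K′ t → K j < K t
    still-later {j} j≢w tj K′j<K′t with <-cmp (K j) (K t)
    ... | tri< Kj<Kt _ _ = Kj<Kt
    ... | tri≈ _ Kj≡Kt _ = contradiction (K-injective Kj≡Kt) (λ j≡t → Adj⇒≢ G tj (sym j≡t))
    ... | tri> _ _ Kt<Kj = contradiction (K-injective (≤-antisym Kj≤Kw (lowest-above tj Kt<Kj))) j≢w
      where
      Kj≤Kw : K j ≤ K w
      Kj≤Kw = *-cancelˡ-≤ 2 (s≤s⁻¹ (subst₂ _<_ (K′-other (λ j≡t → Adj⇒≢ G tj (sym j≡t))) K′-t K′j<K′t))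

  #later′-w : #later G K′ w < #later G K w
  #later′-w = #neighbours-<-at G w (λ j → K′ j <? K′ w) (λ j → K j <? K w)
                (Adj-sym G tw) t-not-later Kt<Kw still-later
    where
    t-not-later : K′ t ≮ K′ w
    t-not-later K′t<K′w = <-asym (n<1+n (2 * K w)) (subst₂ _<_ K′-t (K′-other w≢t) K′t<K′w)
    still-later : ∀ {j} → j ≢ t → Adj G w j → K′ j < K′ w → K j < K w
    still-later j≢t _ K′j<K′w = *-cancelˡ-< 2 _ _ (subst₂ _<_ (K′-other j≢t) (K′-other w≢t) K′j<K′w)

  #later′-other : ∀ {u} → u ≢ t → #later G K′ u ≤ #later G K u
  #later′-other {u} u≢t = #neighbours-mono G u (λ j → K′ j <? K′ u) (λ j → K j <? K u) still-later
    where
    still-later : ∀ {j} → Adj G u j → K′ j < K′ u → K j < K u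
    still-later {j} _ K′j<K′u = by-cases (j ≟ t)
      where
      by-cases : Dec (j ≡ t) → K j < K u
      by-cases (yes j≡t) = subst (λ x → K x < K u) (sym j≡t) (<-trans Kt<Kw (*-cancelˡ-< 2 _ _
        (<-trans (n<1+n _) (subst₂ _<_ (trans (cong K′ j≡t) K′-t) (K′-other u≢t) K′j<K′u))))
      by-cases (no j≢t)  = *-cancelˡ-< 2 _ _ (subst₂ _<_ (K′-other j≢t) (K′-other u≢t) K′j<K′u)

  #later′<chips-w : #later G K′ w < lookup c w
  #later′<chips-w = <-≤-trans #later′-w (#later≤chips w w≢t)

  firingOrder : FiringOrder G (removeChip c w)
  firingOrder = record
    { rank = K′ ; rank-injective = K′-injective ; #later≤chips = ≤-removeChip⁺ c w away-from-w #later′<chips-w }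
    where
    away-from-w : ∀ u → u ≢ w → #later G K′ u ≤ lookup c u
    away-from-w u _ = by-cases (u ≟ t)
      where
      by-cases : Dec (u ≡ t) → #later G K′ u ≤ lookup c u
      by-cases (yes u≡t) = subst (λ x → #later G K′ x ≤ lookup c x) (sym u≡t) (≤-trans #later′-t spare)
      by-cases (no u≢t)  = ≤-trans (#later′-other u≢t) (#later≤chips u u≢t)

  transfer : ∃[ w ] w ≢ t × MinusSelfReachable G c w
  transfer = w , w≢t , ≤-trans (s≤s z≤n) #later′<chips-w , firingOrder⇒selfReachable firingOrder t

unique-removable⇒deg≤#later : ∀ {G : Graph n} {c t K} → (∀ j → MinusSelfReachable G c j → j ≡ t) →
  Injective _≡_ _≡_ K → (∀ u → u ≢ t → #later G K u ≤ lookup c u) → #later G K t < lookup c t →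
  deg G t ≤ #later G K t
unique-removable⇒deg≤#later {G = G} {c} {t} {K} unique K-injective ≤chips <chips = ≮⇒≥ λ #later<deg →
  let w , w≢t , removable = SpareChipTransfer.transfer {G = G} {c} {t} {K} K-injective ≤chips <chips #later<deg
  in w≢t (unique w removable)

-- Attaching a leaf

data LastView : Fin (suc m) → Set where
  last   : LastView (fromℕ m)
  inject : (j : Fin m) → LastView (inject₁ j)

lastView : (i : Fin (suc m)) → LastView i
lastView {zero}  zero    = last
lastView {suc m} zero    = inject zero
lastView {suc m} (suc i) with lastView i
... | last     = last
... | inject j = inject (suc j)

lookup-∷ʳ-inject₁ : ∀ (xs : Vec A m) y i → lookup (xs ∷ʳ y) (inject₁ i) ≡ lookup xs i
lookup-∷ʳ-inject₁ (x ∷ xs) y zero    = refl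
lookup-∷ʳ-inject₁ (x ∷ xs) y (suc i) = lookup-∷ʳ-inject₁ xs y i

lookup-∷ʳ-last : ∀ (xs : Vec A m) y → lookup (xs ∷ʳ y) (fromℕ m) ≡ y
lookup-∷ʳ-last []       y = refl
lookup-∷ʳ-last (x ∷ xs) y = lookup-∷ʳ-last xs y

[]≔-∷ʳ-inject₁ : ∀ (xs : Vec A m) y i z → (xs ∷ʳ y) [ inject₁ i ]≔ z ≡ (xs [ i ]≔ z) ∷ʳ y
[]≔-∷ʳ-inject₁ (x ∷ xs) y zero    z = refl
[]≔-∷ʳ-inject₁ (x ∷ xs) y (suc i) z = cong (x ∷_) ([]≔-∷ʳ-inject₁ xs y i z)

[]≔-∷ʳ-last : ∀ (xs : Vec A m) y z → (xs ∷ʳ y) [ fromℕ m ]≔ z ≡ xs ∷ʳ z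
[]≔-∷ʳ-last []       y z = refl
[]≔-∷ʳ-last (x ∷ xs) y z = cong (x ∷_) ([]≔-∷ʳ-last xs y z)

sum-∷ʳ : ∀ (xs : Vec ℕ m) y → sum (xs ∷ʳ y) ≡ sum xs + y
sum-∷ʳ []       y = +-identityʳ y
sum-∷ʳ (x ∷ xs) y = trans (cong (x +_) (sum-∷ʳ xs y)) (sym (+-assoc x (sum xs) y))

sum-[]≔ : ∀ (xs : Vec ℕ m) i z → sum (xs [ i ]≔ z) + lookup xs i ≡ sum xs + z
sum-[]≔ (x ∷ xs) zero    z = xy∙z≈zy∙x z (sum xs) x
sum-[]≔ (x ∷ xs) (suc i) z = begin
  x + sum (xs [ i ]≔ z) + lookup xs i    ≡⟨ +-assoc x _ _ ⟩
  x + (sum (xs [ i ]≔ z) + lookup xs i)  ≡⟨ cong (x +_) (sum-[]≔ xs i z) ⟩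
  x + (sum xs + z)                       ≡⟨ +-assoc x _ _ ⟨
  x + sum xs + z                         ∎
  where open ≡-Reasoning

removeChip-∷ʳ-inject₁ : ∀ (c : Config m) x i → removeChip (c ∷ʳ x) (inject₁ i) ≡ removeChip c i ∷ʳ x
removeChip-∷ʳ-inject₁ c x i =
  trans (cong (λ y → (c ∷ʳ x) [ inject₁ i ]≔ (y ∸ 1)) (lookup-∷ʳ-inject₁ c x i)) ([]≔-∷ʳ-inject₁ c x i _)

removeChip-∷ʳ-last : ∀ (c : Config m) x → removeChip (c ∷ʳ x) (fromℕ m) ≡ c ∷ʳ (x ∸ 1)
removeChip-∷ʳ-last c x = trans (cong (λ y → (c ∷ʳ x) [ fromℕ _ ]≔ (y ∸ 1)) (lookup-∷ʳ-last c x)) ([]≔-∷ʳ-last c x _)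

module _ (T : Graph (suc m)) where

  #neighbours-deleteLast : ∀ u {P : Pred (Fin (suc m)) 0ℓ} (P? : Decidable P) →
    #neighbours T (inject₁ u) P? ≡
    #neighbours (deleteLast T) u (P? ∘ inject₁) + (if adj T (inject₁ u) (fromℕ m) then 𝟙 (does (P? (fromℕ m))) else 0)
  #neighbours-deleteLast u P? = sum-init-last (λ j → if adj T (inject₁ u) j then 𝟙 (does (P? j)) else 0)

  #neighbours-deleteLast-≤ : ∀ u {P : Pred (Fin (suc m)) 0ℓ} (P? : Decidable P) →
    #neighbours (deleteLast T) u (P? ∘ inject₁) ≤ #neighbours T (inject₁ u) P?
  #neighbours-deleteLast-≤ u P? = ≤-trans (m≤m+n _ _) (≤-reflexive (sym (#neighbours-deleteLast u P?)))

  #neighbours-deleteLast-≡ : ∀ u {P : Pred (Fin (suc m)) 0ℓ} (P? : Decidable P) → ¬ P (fromℕ m) →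
    #neighbours T (inject₁ u) P? ≡ #neighbours (deleteLast T) u (P? ∘ inject₁)
  #neighbours-deleteLast-≡ u P? ¬P = begin
    #neighbours T (inject₁ u) P?  ≡⟨ #neighbours-deleteLast u P? ⟩
    N′ + _                        ≡⟨ cong (N′ +_) last-term ⟩
    N′ + 0                        ≡⟨ +-identityʳ N′ ⟩
    N′                            ∎
    where
    open ≡-Reasoning
    N′ = #neighbours (deleteLast T) u (P? ∘ inject₁)
    last-term : (if adj T (inject₁ u) (fromℕ m) then 𝟙 (does (P? (fromℕ m))) else 0) ≡ 0
    last-term rewrite dec-false (P? (fromℕ m)) ¬P with adj T (inject₁ u) (fromℕ m)
    ... | true  = refl
    ... | false = refl

  deleteLast-connected : Connected T → deg T (fromℕ m) ≤ 1 → Connected (deleteLast T)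
  deleteLast-connected connected leaf u v = avoid-leaf (connected (inject₁ u) (inject₁ v)) refl refl
    where
    avoid-leaf : ∀ {a b} → Walk T a b → ∀ {u v} → a ≡ inject₁ u → b ≡ inject₁ v → Walk (deleteLast T) u v
    avoid-leaf (here _) refl b≡v = subst (Walk _ _) (inject₁-injective b≡v) (here _)
    avoid-leaf (step {v = y} e rest) refl b≡v with lastView y
    ... | inject y′ = step e (avoid-leaf rest refl b≡v)
    ... | last with rest
    ...   | here _        = contradiction b≡v fromℕ≢inject₁
    ...   | step e′ rest′ = avoid-leaf rest′ (deg≤1⇒neighbour-unique T leaf e′ (Adj-sym T e)) b≡v

  firingOrder-restrict : ∀ {c x} → FiringOrder T (c ∷ʳ x) → FiringOrder (deleteLast T) c
  firingOrder-restrict {c} {x} σ = record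
    { rank = rank ∘ inject₁
    ; rank-injective = λ eq → inject₁-injective (rank-injective eq)
    ; #later≤chips = λ u → ≤-trans (#neighbours-deleteLast-≤ u (λ j → rank j <? rank (inject₁ u)))
                             (≤-trans (#later≤chips (inject₁ u)) (≤-reflexive (lookup-∷ʳ-inject₁ c x u))) }
    where open FiringOrder σ

  firingOrder-extend : ∀ {c x} → FiringOrder (deleteLast T) c → deg T (fromℕ m) ≤ x → FiringOrder T (c ∷ʳ x)
  firingOrder-extend {c} {x} σ deg≤x = record { rank = K′ ; rank-injective = K′-injective ; #later≤chips = bound }
    where
    open FiringOrder σ renaming (rank to K)

    K′ : Fin (suc m) → ℕ
    K′ = lookup (tabulate K ∷ʳ strictBound K)

    K′-inject₁ : ∀ j → K′ (inject₁ j) ≡ K j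
    K′-inject₁ j = trans (lookup-∷ʳ-inject₁ (tabulate K) _ j) (lookup∘tabulate K j)

    K′-last : K′ (fromℕ m) ≡ strictBound K
    K′-last = lookup-∷ʳ-last (tabulate K) _

    K′-injective : Injective _≡_ _≡_ K′
    K′-injective {i} {j} eq with lastView i | lastView j
    ... | last     | last     = refl
    ... | last     | inject j = contradiction (trans (sym K′-last) (trans eq (K′-inject₁ j))) (>⇒≢ (<strictBound K j))
    ... | inject i | last     = contradiction (trans (sym K′-last) (trans (sym eq) (K′-inject₁ i))) (>⇒≢ (<strictBound K i))
    ... | inject i | inject j = cong inject₁ (rank-injective (trans (sym (K′-inject₁ i)) (trans eq (K′-inject₁ j))))

    bound : ∀ v → #later T K′ v ≤ lookup (c ∷ʳ x) v
    bound v with lastView v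
    ... | last = begin
      #later T K′ (fromℕ m)      ≤⟨ #neighbours≤deg T (fromℕ m) (λ j → K′ j <? K′ (fromℕ m)) ⟩
      deg T (fromℕ m)            ≤⟨ deg≤x ⟩
      x                          ≡⟨ lookup-∷ʳ-last c x ⟨
      lookup (c ∷ʳ x) (fromℕ m)  ∎
      where open ≤-Reasoning
    ... | inject u = begin
      #later T K′ (inject₁ u)                    ≡⟨ #neighbours-deleteLast-≡ u (λ j → K′ j <? K′ (inject₁ u)) leaf-not-later ⟩
      #neighbours (deleteLast T) u K′-later?     ≡⟨ #neighbours-cong (deleteLast T) u K′-later? (λ j → K j <? K u) same-order ⟩
      #later (deleteLast T) K u                  ≤⟨ #later≤chips u ⟩
      lookup c u                                 ≡⟨ lookup-∷ʳ-inject₁ c x u ⟨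
      lookup (c ∷ʳ x) (inject₁ u)                ∎
      where
      open ≤-Reasoning
      leaf-not-later : ¬ K′ (fromℕ m) < K′ (inject₁ u)
      leaf-not-later = subst₂ (λ a b → ¬ a < b) (sym K′-last) (sym (K′-inject₁ u)) (<⇒≯ (<strictBound K u))
      K′-later? = λ j → K′ (inject₁ j) <? K′ (inject₁ u)
      same-order : ∀ {j} → Adj (deleteLast T) u j → K′ (inject₁ j) < K′ (inject₁ u) ⇔ K j < K u
      same-order {j} _ = mk⇔ (subst₂ _<_ (K′-inject₁ j) (K′-inject₁ u))
                             (subst₂ _<_ (sym (K′-inject₁ j)) (sym (K′-inject₁ u)))

module LeafAttachment {m} (T : Graph (suc m)) (connected : Connected T) (leaf : deg T (fromℕ m) ≡ 1)
                      {t : Fin m} {ν : Config m} (near-min : NearMinSRAbout (deleteLast T) ν t) where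

  private
    T′ = deleteLast T
    d = deg T′ t
    a = lookup ν t
    t-removable = proj₁ (proj₂ (proj₂ near-min))
    only-t      = proj₂ (proj₂ (proj₂ near-min))

  open FiringOrder (selfReachable⇒firingOrder (deleteLast-connected T connected (≤-reflexive leaf)) (proj₂ t-removable))

  #later≤ν : ∀ u → u ≢ t → #later T′ rank u ≤ lookup ν u
  #later≤ν = ≤-removeChip⁻ ν t #later≤chips

  #later<a : #later T′ rank t < a
  #later<a = <-removeChip⁻ ν t #later≤chips (proj₁ t-removable)

  d<a : d < a
  d<a = ≤-<-trans (unique-removable⇒deg≤#later {G = T′} only-t rank-injective #later≤ν #later<a) #later<a

  μ₀ : Config m
  μ₀ = ν [ t ]≔ d

  μ : Config (suc m)
  μ = μ₀ ∷ʳ (a ∸ d + 1)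

  μ₀≤ν : ∀ u → lookup μ₀ u ≤ lookup ν u
  μ₀≤ν u with u ≟ t
  ... | yes refl = subst (_≤ a) (sym (lookup∘update t ν d)) (<⇒≤ d<a)
  ... | no u≢t   = ≤-reflexive (lookup∘update′ u≢t ν d)

  μ₀-firingOrder : FiringOrder T′ μ₀
  μ₀-firingOrder = record { rank = rank ; rank-injective = rank-injective ; #later≤chips = bound }
    where
    bound : ∀ u → #later T′ rank u ≤ lookup μ₀ u
    bound u with u ≟ t
    ... | yes refl = subst (#later T′ rank t ≤_) (sym (lookup∘update t ν d))
                           (#neighbours≤deg T′ t (λ j → rank j <? rank t))
    ... | no u≢t   = subst (#later T′ rank u ≤_) (sym (lookup∘update′ u≢t ν d)) (#later≤ν u u≢t)

  extend-μ₀ : ∀ {x} → 1 ≤ x → SelfReachable T (μ₀ ∷ʳ x)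
  extend-μ₀ {x} 1≤x = firingOrder⇒selfReachable
    (firingOrder-extend T μ₀-firingOrder (subst (_≤ x) (sym leaf) 1≤x)) (fromℕ m)

  μ-selfReachable : SelfReachable T μ
  μ-selfReachable = extend-μ₀ (m≤n+m 1 _)

  leaf-removable : MinusSelfReachable T μ (fromℕ m)
  leaf-removable =
    subst (1 ≤_) (sym (lookup-∷ʳ-last μ₀ _)) (m≤n+m 1 _) ,
    subst (SelfReachable T) (sym (removeChip-∷ʳ-last μ₀ _)) (extend-μ₀ 1≤a∸d)
    where
    1≤a∸d : 1 ≤ a ∸ d + 1 ∸ 1
    1≤a∸d = subst (1 ≤_) (sym (m+n∸n≡m (a ∸ d) 1)) (m<n⇒0<n∸m d<a)

  private
    inner-chips : ∀ {j} → MinusSelfReachable T μ (inject₁ j) → 1 ≤ lookup μ₀ j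
    inner-chips {j} (1≤μj , _) = subst (1 ≤_) (lookup-∷ʳ-inject₁ μ₀ _ j) 1≤μj

    inner-order : ∀ {j} → MinusSelfReachable T μ (inject₁ j) → FiringOrder T′ (removeChip μ₀ j)
    inner-order {j} (_ , removable) = firingOrder-restrict T
      (subst (FiringOrder T) (removeChip-∷ʳ-inject₁ μ₀ _ j) (selfReachable⇒firingOrder connected removable))

  t-not-removable : ¬ MinusSelfReachable T μ (inject₁ t)
  t-not-removable removable = <⇒≱ #later<d d≤#later
    where
    open FiringOrder (inner-order removable)
      renaming (rank to K; rank-injective to K-injective; #later≤chips to #later≤μ₀)
    #later<d : #later T′ K t < d
    #later<d = subst (#later T′ K t <_) (lookup∘update t ν d) (<-removeChip⁻ μ₀ t #later≤μ₀ (inner-chips removable))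
    #later≤ν′ : ∀ u → u ≢ t → #later T′ K u ≤ lookup ν u
    #later≤ν′ u u≢t = ≤-trans (≤-removeChip⁻ μ₀ t #later≤μ₀ u u≢t) (μ₀≤ν u)
    d≤#later : d ≤ #later T′ K t
    d≤#later = unique-removable⇒deg≤#later {G = T′} only-t K-injective #later≤ν′ (<-trans #later<d d<a)

  inner-not-removable : ∀ {j} → j ≢ t → ¬ MinusSelfReachable T μ (inject₁ j)
  inner-not-removable {j} j≢t removable =
    j≢t (only-t j (≤-trans (inner-chips removable) (μ₀≤ν j) , firingOrder⇒selfReachable ν-order t))
    where
    ν-order : FiringOrder T′ (removeChip ν j)
    ν-order = firingOrder-mono (inner-order removable) (removeChip-mono {c = μ₀} {ν} μ₀≤ν j)

  only-leaf-removable : ∀ j → MinusSelfReachable T μ j → j ≡ fromℕ m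
  only-leaf-removable j removable with lastView j
  ... | last = refl
  ... | inject j′ with j′ ≟ t
  ...   | yes refl = contradiction removable t-not-removable
  ...   | no j′≢t  = contradiction removable (inner-not-removable j′≢t)

  sum-μ : ∀ {ℓ} → sum ν ≡ ℓ → sum μ ≡ suc ℓ
  sum-μ refl = begin
    sum μ                       ≡⟨ sum-∷ʳ μ₀ _ ⟩
    sum μ₀ + (a ∸ d + 1)        ≡⟨ +-assoc (sum μ₀) (a ∸ d) 1 ⟨
    sum μ₀ + (a ∸ d) + 1        ≡⟨ cong (_+ 1) (+-cancelʳ-≡ d _ _ balance) ⟩
    sum ν + 1                   ≡⟨ +-comm (sum ν) 1 ⟩
    suc (sum ν)                 ∎
    where
    open ≡-Reasoning
    balance : sum μ₀ + (a ∸ d) + d ≡ sum ν + d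
    balance = trans (+-assoc (sum μ₀) (a ∸ d) d) (trans (cong (sum μ₀ +_) (m∸n+n≡m (<⇒≤ d<a))) (sum-[]≔ ν t d))

  not-minimal : ∀ {ℓ} → suc m ≤ ℓ → sum ν ≡ ℓ → ¬ MinimallySelfReachable T μ
  not-minimal {ℓ} m<ℓ sum-ν (_ , sum≡m) = <⇒≢ (<-trans m<ℓ (n<1+n ℓ)) (trans (sym sum≡m) (sum-μ sum-ν))

  μ-nearMin : ∀ {ℓ} → suc m ≤ ℓ → sum ν ≡ ℓ → NearMinSRAbout T μ (fromℕ m)
  μ-nearMin m<ℓ sum-ν = μ-selfReachable , not-minimal m<ℓ sum-ν , leaf-removable , only-leaf-removable

  μ-as-stated : (ν [ t ]≔ (a ∸ (a ∸ d))) ∷ʳ (a ∸ d + 1) ≡ μ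
  μ-as-stated = cong (λ z → (ν [ t ]≔ z) ∷ʳ (a ∸ d + 1)) (m∸[m∸n]≡n (<⇒≤ d<a))

lemma5p8 : (k : ℕ) (T : Graph (suc (suc k))) → IsTree T
    → deg T (fromℕ (suc k)) ≡ 1
    → adj T (fromℕ (suc k)) (inject₁ (fromℕ k)) ≡ true
    → (t : Fin (suc k)) (ℓ : ℕ) → suc (suc k) ≤ ℓ
    → (ν : Config (suc k)) → sum ν ≡ ℓ
    → NearMinSRAbout (deleteLast T) ν t
    → (deg (deleteLast T) t ≤ lookup ν t)
      × NearMinSRAbout T
          ((ν [ t ]≔ (lookup ν t ∸ (lookup ν t ∸ deg (deleteLast T) t)))
            ∷ʳ (lookup ν t ∸ deg (deleteLast T) t + 1))
          (fromℕ (suc k))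
      × sum ((ν [ t ]≔ (lookup ν t ∸ (lookup ν t ∸ deg (deleteLast T) t)))
            ∷ʳ (lookup ν t ∸ deg (deleteLast T) t + 1)) ≡ suc ℓ
-- Which vertex the leaf hangs from is irrelevant; only deg T vₙ ≡ 1 is used.
lemma5p8 k T tree leaf _ t ℓ n≤ℓ ν sum-ν near-min =
  <⇒≤ d<a ,
  subst (λ μ′ → NearMinSRAbout T μ′ (fromℕ (suc k)) × sum μ′ ≡ suc ℓ) (sym μ-as-stated)
    (μ-nearMin n≤ℓ sum-ν , sum-μ sum-ν)
  where open LeafAttachment T (proj₁ tree) leaf near-min
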